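{- For every non-negative integer $N$, \[\sum_{\pi\in\mathcal{D}_{\le N}} q^{\mathcal{O}(\pi)} z^{\gamma(\pi)} = \sum_{k=0}^N q^k z^k {N\brack k}_q,\qquad \sum_{\pi\in\mathcal{P}_{\le N}} q^{\mathcal{O}(\pi)} z^{\gamma(\pi)} = \sum_{k=0}^N \frac{q^k z^k}{(q;q)_k(q;q)_{N-k}}.\]
   Context: A partition $\pi=(\lambda_1,\lambda_2,\dots)$ is a finite non-increasing sequence of positive integers; the empty sequence is the unique partition of $0$. $\mathcal{P}_{\le N}$ is the set of partitions with all parts $\le N$ and $\mathcal{D}_{\le N}$ the set of partitions into distinct parts, all $\le N$. $\mathcal{O}(\pi)=\lambda_1+\lambda_3+\cdots$ and $\gamma(\pi)=\lambda_1-\lambda_2+\lambda_3-\lambda_4+\cdots$. $(a;q)_l=\prod_{i=0}^{l-1}(1-aq^i)$, and ${n+m\brack n}_q=\frac{(q;q)_{n+m}}{(q;q)_n(q;q)_m}$ for $n,m\ge0$ and $0$ otherwise. Identities are of formal power series in $q$ with polynomial coefficients in $z$. -}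

module Defs where

open import Data.Nat as ℕ using (ℕ; zero; suc; _∸_; _≤_; _<_; _≥_; _>_; _≤ᵇ_)
open import Data.Integer as ℤ using (ℤ; +_; _-_; -_)
open import Data.List using (List; []; _∷_; length)
open import Data.List.Relation.Unary.All using (All)
open import Data.List.Relation.Unary.Linked using (Linked)
open import Data.List.Relation.Unary.Unique.Propositional using (Unique)
open import Data.List.Membership.Propositional using (_∈_)
open import Data.Product using (_×_; Σ)
open import Data.Bool using (if_then_else_)
open import Relation.Binary.PropositionalEquality using (_≡_)

IsPartitionLe : ℕ → List ℕ → Set
IsPartitionLe N π = Linked _≥_ π × All (λ x → 0 < x × x ≤ N) π

IsDistinctPartitionLe : ℕ → List ℕ → Set
IsDistinctPartitionLe N π = Linked _>_ π × All (λ x → 0 < x × x ≤ N) π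

𝒪 : List ℕ → ℕ
𝒪 [] = 0
𝒪 (x ∷ []) = x
𝒪 (x ∷ y ∷ xs) = x ℕ.+ 𝒪 xs

γ : List ℕ → ℤ
γ [] = + 0
γ (x ∷ xs) = + x - γ xs

HasCardinality : (List ℕ → Set) → ℤ → Set
HasCardinality P c =
  Σ (List (List ℕ)) λ L →
    Unique L × (∀ π → (π ∈ L → P π) × (P π → π ∈ L)) × (+ length L ≡ c)

-- Formal power series in q with polynomial coefficients in z (over ℤ).
-- A series F is given by its coefficients: F n m = [q^n z^m] F.

Poly : Set
Poly = ℕ → ℤ

Ser : Set
Ser = ℕ → Poly

sumTo : ℕ → (ℕ → ℤ) → ℤ
sumTo zero f = f 0
sumTo (suc n) f = sumTo n f ℤ.+ f (suc n)

δ : ℕ → ℕ → ℤ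
δ zero zero = + 1
δ zero (suc _) = + 0
δ (suc _) zero = + 0
δ (suc a) (suc b) = δ a b

zeroS : Ser
zeroS _ _ = + 0

mono : ℕ → ℕ → Ser
mono a b n m = δ a n ℤ.* δ b m

oneS : Ser
oneS = mono 0 0

_⊕_ : Ser → Ser → Ser
(f ⊕ g) n m = f n m ℤ.+ g n m

_⊖_ : Ser → Ser → Ser
(f ⊖ g) n m = f n m - g n m

_⊛_ : Ser → Ser → Ser
(f ⊛ g) n m = sumTo n λ i → sumTo m λ j → f i j ℤ.* g (n ∸ i) (m ∸ j)

sumS : ℕ → (ℕ → Ser) → Ser
sumS zero F = F 0
sumS (suc N) F = sumS N F ⊕ F (suc N)

pmul : Poly → Poly → Poly
pmul p r m = sumTo m λ j → p j ℤ.* r (m ∸ j)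

padd : Poly → Poly → Poly
padd p r m = p m ℤ.+ r m

pzero : Poly
pzero _ = + 0

pone : Poly
pone = δ 0

-- Multiplicative inverse of a series F whose q^0-coefficient is the
-- polynomial 1:  G 0 = 1,  G n = - Σ_{i=1}^{n} F i · G (n - i).
-- invList F n = [G n, G (n-1), …, G 0].
invList : Ser → ℕ → List Poly
invList F zero = pone ∷ []
invList F (suc n) = new ∷ prev
  where
  prev : List Poly
  prev = invList F n
  go : ℕ → List Poly → Poly
  go i [] = pzero
  go i (p ∷ ps) = padd (pmul (F i) p) (go (suc i) ps)
  new : Poly
  new m = - go 1 prev m

headP : List Poly → Poly
headP [] = pzero
headP (p ∷ _) = p

inv : Ser → Ser
inv F n = headP (invList F n)

qPoch : ℕ → Ser
qPoch zero = oneS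
qPoch (suc l) = qPoch l ⊛ (oneS ⊖ mono (suc l) 0)

qBinom : ℕ → ℕ → Ser
qBinom N k = if k ≤ᵇ N then qPoch N ⊛ inv (qPoch k ⊛ qPoch (N ∸ k)) else zeroS

RHS₁ : ℕ → Ser
RHS₁ N = sumS N λ k → mono k k ⊛ qBinom N k

RHS₂ : ℕ → Ser
RHS₂ N = sumS N λ k → mono k k ⊛ inv (qPoch k ⊛ qPoch (N ∸ k))

-- Deleting the first part a of a partition changes its statistics (𝒪, γ) = (n, m) into
-- (n − m, a − m), because 𝒪 drops by exactly γ.  Sorting the partitions in 𝒟≤N+1 (resp. 𝒫≤N+1)
-- by whether their first part is N + 1 therefore gives
--   c(N + 1, n, m) = c(N, n, m) + c′(n − m, N + 1 − m),
-- where c′ counts 𝒟≤N (resp. 𝒫≤N+1).  The coefficient of z^m on the right is q^m [N, m]_q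
-- (resp. q^m / ((q;q)_m (q;q)_{N−m})), and these satisfy the same recurrence by the q-Pascal rule
-- (resp. its analogue for 1 / ((q;q)_a (q;q)_b)); both rules come from
-- 1 − q^(a+b) = (1 − q^a) + q^a (1 − q^b).  The initial values agree; for 𝒫 the recursion is
-- well founded in n, since the tail count stays at parts ≤ N + 1.

module Submission where

open import Defs
open import Data.Nat using (ℕ; zero; suc; _∸_; _≤_; _<_; _≥_; _>_; z≤n; s≤s; z<s; _≤?_)
import Data.Nat as ℕ
import Data.Nat.Properties as ℕ
open import Data.Nat.Induction using (<-rec)
open import Data.Integer using (ℤ; +_; -_; _+_; _-_; _*_)
import Data.Integer.Properties as ℤ
open import Data.Integer.Tactic.RingSolver using (solve-∀)
open import Data.Bool using (true; false)
open import Data.List using (List; []; _∷_; _++_; map; length)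
open import Data.List.Properties using (length-++; length-map; ∷-injectiveʳ)
open import Data.List.Relation.Unary.All as All using (All; []; _∷_)
open import Data.List.Relation.Unary.Any using (here)
open import Data.List.Relation.Unary.AllPairs using ([]; _∷_)
open import Data.List.Relation.Unary.Linked as Linked using (Linked; []; [-]; _∷_)
open import Data.List.Relation.Unary.Linked.Properties using (Linked⇒All)
open import Data.List.Membership.Propositional using (_∈_)
open import Data.List.Membership.Propositional.Properties using (∈-++⁺ˡ; ∈-++⁺ʳ; ∈-++⁻; ∈-map⁺; ∈-map⁻)
import Data.List.Relation.Unary.Unique.Propositional.Properties as Unique
open import Data.Product using (Σ; _×_; _,_; proj₁; proj₂; map₁)
open import Data.Sum using (_⊎_; inj₁; inj₂; [_,_])
open import Data.Empty using (⊥-elim)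
open import Function using (_∘_; _⇔_; mk⇔; Equivalence)
open import Function.Properties.Equivalence using () renaming (sym to ⇔-sym)
open import Relation.Nullary using (¬_; yes; no)
open import Relation.Binary.PropositionalEquality hiding ([_])
import Relation.Binary.Reasoning.Setoid

open Equivalence using (to; from)

sumTo-cong : ∀ n {f g : ℕ → ℤ} → (∀ i → i ≤ n → f i ≡ g i) → sumTo n f ≡ sumTo n g
sumTo-cong zero    f≡g = f≡g 0 z≤n
sumTo-cong (suc n) f≡g = cong₂ _+_ (sumTo-cong n λ i i≤n → f≡g i (ℕ.m≤n⇒m≤1+n i≤n)) (f≡g (suc n) ℕ.≤-refl)

sumTo-zero : ∀ n {f : ℕ → ℤ} → (∀ i → i ≤ n → f i ≡ + 0) → sumTo n f ≡ + 0
sumTo-zero zero    f≡0 = f≡0 0 z≤n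
sumTo-zero (suc n) f≡0 = cong₂ _+_ (sumTo-zero n λ i i≤n → f≡0 i (ℕ.m≤n⇒m≤1+n i≤n)) (f≡0 (suc n) ℕ.≤-refl)

sumTo-unfoldˡ : ∀ n (f : ℕ → ℤ) → sumTo (suc n) f ≡ f 0 + sumTo n (λ i → f (suc i))
sumTo-unfoldˡ zero    f = refl
sumTo-unfoldˡ (suc n) f = trans (cong (_+ f (suc (suc n))) (sumTo-unfoldˡ n f)) (ℤ.+-assoc (f 0) _ _)

sumTo-+ : ∀ n (f g : ℕ → ℤ) → sumTo n (λ i → f i + g i) ≡ sumTo n f + sumTo n g
sumTo-+ zero    f g = refl
sumTo-+ (suc n) f g = trans (cong (_+ (f (suc n) + g (suc n))) (sumTo-+ n f g))
                             (interchange (sumTo n f) (sumTo n g) (f (suc n)) (g (suc n)))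
  where
  interchange : ∀ a b c d → (a + b) + (c + d) ≡ (a + c) + (b + d)
  interchange = solve-∀

sumTo-neg : ∀ n (f : ℕ → ℤ) → sumTo n (λ i → - f i) ≡ - sumTo n f
sumTo-neg zero    f = refl
sumTo-neg (suc n) f = trans (cong (_+ - f (suc n)) (sumTo-neg n f)) (sym (ℤ.neg-distrib-+ (sumTo n f) (f (suc n))))

sumTo-*ˡ : ∀ n c (f : ℕ → ℤ) → sumTo n (λ i → c * f i) ≡ c * sumTo n f
sumTo-*ˡ zero    c f = refl
sumTo-*ˡ (suc n) c f = trans (cong (_+ c * f (suc n)) (sumTo-*ˡ n c f)) (sym (ℤ.*-distribˡ-+ c (sumTo n f) (f (suc n))))

sumTo-*ʳ : ∀ n c (f : ℕ → ℤ) → sumTo n (λ i → f i * c) ≡ sumTo n f * c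
sumTo-*ʳ zero    c f = refl
sumTo-*ʳ (suc n) c f = trans (cong (_+ f (suc n) * c) (sumTo-*ʳ n c f)) (sym (ℤ.*-distribʳ-+ c (sumTo n f) (f (suc n))))

sumTo-reverse : ∀ n (f : ℕ → ℤ) → sumTo n f ≡ sumTo n (λ i → f (n ∸ i))
sumTo-reverse zero    f = refl
sumTo-reverse (suc n) f = begin
  sumTo n f + f (suc n)                      ≡⟨ cong (_+ f (suc n)) (sumTo-reverse n f) ⟩
  sumTo n (λ i → f (n ∸ i)) + f (suc n)      ≡⟨ ℤ.+-comm _ (f (suc n)) ⟩
  f (suc n) + sumTo n (λ i → f (n ∸ i))      ≡⟨ sym (sumTo-unfoldˡ n (λ i → f (suc n ∸ i))) ⟩
  sumTo (suc n) (λ i → f (suc n ∸ i))        ∎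
  where open ≡-Reasoning

sumTo-single : ∀ n a (f : ℕ → ℤ) → (∀ i → i ≢ a → f i ≡ + 0) →
               (a ≤ n → sumTo n f ≡ f a) × (n < a → sumTo n f ≡ + 0)
sumTo-single n a f f≡0 = inside n , outside n
  where
  outside : ∀ n → n < a → sumTo n f ≡ + 0
  outside n n<a = sumTo-zero n λ i i≤n → f≡0 i (ℕ.<⇒≢ (ℕ.≤-<-trans i≤n n<a))
  inside : ∀ n → a ≤ n → sumTo n f ≡ f a
  inside zero    z≤n = refl
  inside (suc n) a≤1+n with a ℕ.≟ suc n
  ... | yes refl = trans (cong (_+ f (suc n)) (outside n ℕ.≤-refl)) (ℤ.+-identityˡ _)
  ... | no  a≢1+n = trans (cong₂ _+_ (inside n (ℕ.≤-pred (ℕ.≤∧≢⇒< a≤1+n a≢1+n))) (f≡0 (suc n) (a≢1+n ∘ sym)))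
                          (ℤ.+-identityʳ _)

sumTo-triangle : ∀ n (F : ℕ → ℕ → ℤ) →
                 sumTo n (λ s → sumTo s (λ i → F i s)) ≡ sumTo n (λ i → sumTo (n ∸ i) (λ t → F i (i ℕ.+ t)))
sumTo-triangle zero    F = refl
sumTo-triangle (suc n) F = begin
    sumTo n (λ s → sumTo s (λ i → F i s)) + (sumTo n (λ i → F i (suc n)) + F (suc n) (suc n))
  ≡⟨ cong (_+ (sumTo n (λ i → F i (suc n)) + F (suc n) (suc n))) (sumTo-triangle n F) ⟩
    R + (sumTo n (λ i → F i (suc n)) + F (suc n) (suc n))
  ≡⟨ sym (ℤ.+-assoc R _ _) ⟩
    (R + sumTo n (λ i → F i (suc n))) + F (suc n) (suc n)
  ≡⟨ cong₂ _+_ (sym (sumTo-+ n _ _)) (cong (F (suc n)) (sym (ℕ.+-identityʳ (suc n)))) ⟩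
    sumTo n (λ i → sumTo (n ∸ i) (λ t → F i (i ℕ.+ t)) + F i (suc n)) + F (suc n) (suc n ℕ.+ 0)
  ≡⟨ cong₂ _+_ (sumTo-cong n extend) (cong (λ k → sumTo k (λ t → F (suc n) (suc n ℕ.+ t))) (sym (ℕ.n∸n≡0 n))) ⟩
    sumTo n (λ i → sumTo (suc n ∸ i) (λ t → F i (i ℕ.+ t))) + sumTo (suc n ∸ suc n) (λ t → F (suc n) (suc n ℕ.+ t))
  ∎
  where
  open ≡-Reasoning
  R = sumTo n (λ i → sumTo (n ∸ i) (λ t → F i (i ℕ.+ t)))
  extend : ∀ i → i ≤ n →
           sumTo (n ∸ i) (λ t → F i (i ℕ.+ t)) + F i (suc n) ≡ sumTo (suc n ∸ i) (λ t → F i (i ℕ.+ t))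
  extend i i≤n rewrite ℕ.+-∸-assoc 1 i≤n =
    cong (λ k → sumTo (n ∸ i) (λ t → F i (i ℕ.+ t)) + F i k)
         (sym (trans (ℕ.+-suc i (n ∸ i)) (cong suc (ℕ.m+[n∸m]≡n i≤n))))

QSeries : Set
QSeries = ℕ → ℤ

infixl 7 _⊠_
infixl 6 _⊞_ _⊟_

_⊞_ : QSeries → QSeries → QSeries
(f ⊞ g) n = f n + g n

_⊟_ : QSeries → QSeries → QSeries
(f ⊟ g) n = f n - g n

_⊠_ : QSeries → QSeries → QSeries
(f ⊠ g) n = sumTo n λ i → f i * g (n ∸ i)

q^_ : ℕ → QSeries
q^ a = δ a

0# 1# : QSeries
0# _ = + 0
1# = q^ 0

module ≗-Reasoning = Relation.Binary.Reasoning.Setoid (ℕ →-setoid ℤ)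

⊠-cong : ∀ {f f′ g g′} → f ≗ f′ → g ≗ g′ → f ⊠ g ≗ f′ ⊠ g′
⊠-cong f≗f′ g≗g′ n = sumTo-cong n λ i _ → cong₂ _*_ (f≗f′ i) (g≗g′ (n ∸ i))

⊠-congˡ : ∀ {f f′} g → f ≗ f′ → f ⊠ g ≗ f′ ⊠ g
⊠-congˡ g f≗f′ = ⊠-cong {g = g} f≗f′ (λ _ → refl)

⊠-congʳ : ∀ f {g g′} → g ≗ g′ → f ⊠ g ≗ f ⊠ g′
⊠-congʳ f g≗g′ = ⊠-cong {f = f} (λ _ → refl) g≗g′

⊠-comm : ∀ f g → f ⊠ g ≗ g ⊠ f
⊠-comm f g n = trans (sumTo-reverse n _) (sumTo-cong n λ i i≤n →
  trans (cong (λ k → f (n ∸ i) * g k) (ℕ.m∸[m∸n]≡n i≤n)) (ℤ.*-comm (f (n ∸ i)) (g i)))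

⊠-assoc : ∀ f g h → f ⊠ g ⊠ h ≗ f ⊠ (g ⊠ h)
⊠-assoc f g h n = begin
    sumTo n (λ s → sumTo s (λ i → f i * g (s ∸ i)) * h (n ∸ s))
  ≡⟨ sumTo-cong n (λ s _ → sym (sumTo-*ʳ s (h (n ∸ s)) _)) ⟩
    sumTo n (λ s → sumTo s (λ i → F i s))
  ≡⟨ sumTo-triangle n F ⟩
    sumTo n (λ i → sumTo (n ∸ i) (λ t → F i (i ℕ.+ t)))
  ≡⟨ sumTo-cong n (λ i _ → sumTo-cong (n ∸ i) λ t _ → reassociate i t) ⟩
    sumTo n (λ i → sumTo (n ∸ i) (λ t → f i * (g t * h (n ∸ i ∸ t))))
  ≡⟨ sumTo-cong n (λ i _ → sumTo-*ˡ (n ∸ i) (f i) _) ⟩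
    sumTo n (λ i → f i * sumTo (n ∸ i) (λ t → g t * h (n ∸ i ∸ t)))
  ∎
  where
  open ≡-Reasoning
  F : ℕ → ℕ → ℤ
  F i s = f i * g (s ∸ i) * h (n ∸ s)
  reassociate : ∀ i t → F i (i ℕ.+ t) ≡ f i * (g t * h (n ∸ i ∸ t))
  reassociate i t rewrite ℕ.m+n∸m≡n i t | ℕ.∸-+-assoc n i t = ℤ.*-assoc (f i) (g t) _

⊠-distribˡ-⊞ : ∀ f g h → f ⊠ (g ⊞ h) ≗ f ⊠ g ⊞ f ⊠ h
⊠-distribˡ-⊞ f g h n =
  trans (sumTo-cong n λ i _ → ℤ.*-distribˡ-+ (f i) (g (n ∸ i)) (h (n ∸ i))) (sumTo-+ n _ _)

⊠-distribˡ-⊟ : ∀ f g h → f ⊠ (g ⊟ h) ≗ f ⊠ g ⊟ f ⊠ h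
⊠-distribˡ-⊟ f g h n = begin
    sumTo n (λ i → f i * (g (n ∸ i) - h (n ∸ i)))
  ≡⟨ sumTo-cong n (λ i _ → distrib (f i) (g (n ∸ i)) (h (n ∸ i))) ⟩
    sumTo n (λ i → f i * g (n ∸ i) + - (f i * h (n ∸ i)))
  ≡⟨ sumTo-+ n _ _ ⟩
    (f ⊠ g) n + sumTo n (λ i → - (f i * h (n ∸ i)))
  ≡⟨ cong (λ x → (f ⊠ g) n + x) (sumTo-neg n _) ⟩
    (f ⊠ g) n - (f ⊠ h) n
  ∎
  where
  open ≡-Reasoning
  distrib : ∀ a b c → a * (b - c) ≡ a * b + - (a * c)
  distrib = solve-∀

⊞-cong : ∀ {f f′ g g′} → f ≗ f′ → g ≗ g′ → f ⊞ g ≗ f′ ⊞ g′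
⊞-cong f≗f′ g≗g′ n = cong₂ _+_ (f≗f′ n) (g≗g′ n)

⊞-identityˡ : ∀ f → 0# ⊞ f ≗ f
⊞-identityˡ f n = ℤ.+-identityˡ (f n)

⊞-identityʳ : ∀ f → f ⊞ 0# ≗ f
⊞-identityʳ f n = ℤ.+-identityʳ (f n)

⊠-zeroʳ : ∀ f → f ⊠ 0# ≗ 0#
⊠-zeroʳ f n = sumTo-zero n λ i _ → ℤ.*-zeroʳ (f i)

δ-refl : ∀ a → δ a a ≡ + 1
δ-refl zero    = refl
δ-refl (suc a) = δ-refl a

δ-≢ : ∀ {a b} → a ≢ b → δ a b ≡ + 0
δ-≢ {zero}  {zero}  a≢b = ⊥-elim (a≢b refl)
δ-≢ {zero}  {suc b} a≢b = refl
δ-≢ {suc a} {zero}  a≢b = refl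
δ-≢ {suc a} {suc b} a≢b = δ-≢ (a≢b ∘ cong suc)

q^-⊠ : ∀ a f n → (a ≤ n → (q^ a ⊠ f) n ≡ f (n ∸ a)) × (n < a → (q^ a ⊠ f) n ≡ + 0)
q^-⊠ a f n = map₁ (λ at-a a≤n → trans (at-a a≤n) (trans (cong (_* f (n ∸ a)) (δ-refl a)) (ℤ.*-identityˡ _)))
                  (sumTo-single n a (λ i → δ a i * f (n ∸ i)) λ i i≢a →
                     trans (cong (_* f (n ∸ i)) (δ-≢ (i≢a ∘ sym))) (ℤ.*-zeroˡ (f (n ∸ i))))

⊠-identityˡ : ∀ f → 1# ⊠ f ≗ f
⊠-identityˡ f n = proj₁ (q^-⊠ 0 f n) z≤n

⊠-identityʳ : ∀ f → f ⊠ 1# ≗ f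
⊠-identityʳ f n = trans (⊠-comm f 1# n) (⊠-identityˡ f n)

q^-+ : ∀ a b → q^ a ⊠ q^ b ≗ q^ (a ℕ.+ b)
q^-+ a b n with a ≤? n
... | yes a≤n = trans (proj₁ (q^-⊠ a (q^ b) n) a≤n) (shift a n a≤n)
  where
  shift : ∀ a n → a ≤ n → δ b (n ∸ a) ≡ δ (a ℕ.+ b) n
  shift zero    n       _         = refl
  shift (suc a) (suc n) (s≤s a≤n) = shift a n a≤n
... | no  a≰n = trans (proj₂ (q^-⊠ a (q^ b) n) n<a)
                      (sym (δ-≢ λ a+b≡n → ℕ.<⇒≱ n<a (subst (a ≤_) a+b≡n (ℕ.m≤m+n a b))))
  where n<a = ℕ.≰⇒> a≰n

-- Inverting a series with constant term 1

zSlice : Ser → ℕ → QSeries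
zSlice F m n = F n m

zSlice-index : ∀ F {j j′} → j ≡ j′ → zSlice F j ≗ zSlice F j′
zSlice-index F j≡j′ n = cong (F n) j≡j′

convolveTail : Ser → ℕ → List Poly → Poly
convolveTail F i []       = pzero
convolveTail F i (p ∷ ps) = padd (pmul (F i) p) (convolveTail F (suc i) ps)

convolveTail-unique : ∀ F {g : ℕ → List Poly → Poly} →
                      (∀ i → g i [] ≡ pzero) → (∀ i p ps → g i (p ∷ ps) ≡ padd (pmul (F i) p) (g (suc i) ps)) →
                      ∀ i ps m → g i ps m ≡ convolveTail F i ps m
convolveTail-unique F     g[] g∷ i []       m = cong (λ p → p m) (g[] i)
convolveTail-unique F {g} g[] g∷ i (p ∷ ps) m rewrite g∷ i p ps =
  cong (λ x → pmul (F i) p m + x) (convolveTail-unique F {g} g[] g∷ (suc i) ps m)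

-- The recursion step of inv is local to invList; unification recovers it from its defining equations.
inv-suc : ∀ F n m → inv F (suc n) m ≡ - convolveTail F 1 (invList F n) m
inv-suc F n with invList F n | 1 | convolveTail-unique F {g = _}
... | ps | i | unique = λ m → cong -_ (unique (λ _ → refl) (λ _ _ _ → refl) i ps m)

convolveTail-invList : ∀ F k j →
  convolveTail F k (invList F j) 0 ≡ sumTo j (λ t → F (k ℕ.+ t) 0 * inv F (j ∸ t) 0)
convolveTail-invList F k zero rewrite ℕ.+-identityʳ k = ℤ.+-identityʳ _
convolveTail-invList F k (suc j) = begin
    F k 0 * inv F (suc j) 0 + convolveTail F (suc k) (invList F j) 0
  ≡⟨ cong₂ _+_ (cong (λ i → F i 0 * inv F (suc j) 0) (sym (ℕ.+-identityʳ k))) (convolveTail-invList F (suc k) j) ⟩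
    F (k ℕ.+ 0) 0 * inv F (suc j) 0 + sumTo j (λ t → F (suc k ℕ.+ t) 0 * inv F (j ∸ t) 0)
  ≡⟨ cong (λ x → F (k ℕ.+ 0) 0 * inv F (suc j) 0 + x)
          (sumTo-cong j λ t _ → cong (λ i → F i 0 * inv F (j ∸ t) 0) (sym (ℕ.+-suc k t))) ⟩
    F (k ℕ.+ 0) 0 * inv F (suc j) 0 + sumTo j (λ t → F (k ℕ.+ suc t) 0 * inv F (j ∸ t) 0)
  ≡⟨ sym (sumTo-unfoldˡ j (λ t → F (k ℕ.+ t) 0 * inv F (suc j ∸ t) 0)) ⟩
    sumTo (suc j) (λ t → F (k ℕ.+ t) 0 * inv F (suc j ∸ t) 0)
  ∎
  where open ≡-Reasoning

inv-inverse : ∀ F → F 0 0 ≡ + 1 → zSlice F 0 ⊠ zSlice (inv F) 0 ≗ 1#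
inv-inverse F F₀₀≡1 zero rewrite F₀₀≡1 = refl
inv-inverse F F₀₀≡1 (suc n) = begin
    sumTo (suc n) (λ i → F i 0 * inv F (suc n ∸ i) 0)
  ≡⟨ sumTo-unfoldˡ n _ ⟩
    F 0 0 * inv F (suc n) 0 + S
  ≡⟨ cong₂ (λ a b → a * b + S) F₀₀≡1 (trans (inv-suc F n 0) (cong -_ (convolveTail-invList F 1 n))) ⟩
    + 1 * - S + S
  ≡⟨ cancel S ⟩
    + 0
  ∎
  where
  open ≡-Reasoning
  S = sumTo n (λ i → F (suc i) 0 * inv F (n ∸ i) 0)
  cancel : ∀ s → + 1 * - s + s ≡ + 0
  cancel = solve-∀

inverse-unique : ∀ {f f′} g → f ⊠ g ≗ 1# → f′ ⊠ g ≗ 1# → f ≗ f′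
inverse-unique {f} {f′} g fg≗1 f′g≗1 = begin
  f             ≈⟨ ⊠-identityʳ f ⟨
  f ⊠ 1#        ≈⟨ ⊠-congʳ f (λ n → trans (sym (f′g≗1 n)) (⊠-comm f′ g n)) ⟩
  f ⊠ (g ⊠ f′)  ≈⟨ ⊠-assoc f g f′ ⟨
  f ⊠ g ⊠ f′    ≈⟨ ⊠-congˡ f′ fg≗1 ⟩
  1# ⊠ f′       ≈⟨ ⊠-identityˡ f′ ⟩
  f′            ∎
  where open ≗-Reasoning

-- q-Pochhammer symbols and q-binomial coefficients

1-q^-+ : ∀ a b → 1# ⊟ q^ (a ℕ.+ b) ≗ (1# ⊟ q^ a) ⊞ q^ a ⊠ (1# ⊟ q^ b)
1-q^-+ a b n = begin
  1# n - δ (a ℕ.+ b) n                  ≡⟨ telescope (1# n) (δ a n) (δ (a ℕ.+ b) n) ⟩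
  (1# n - δ a n) + (δ a n - δ (a ℕ.+ b) n) ≡⟨ cong (λ x → (1# n - δ a n) + x) q^a⊠[1-q^b] ⟨
  (1# n - δ a n) + (q^ a ⊠ (1# ⊟ q^ b)) n  ∎
  where
  open ≡-Reasoning
  telescope : ∀ u v w → u - w ≡ (u - v) + (v - w)
  telescope = solve-∀
  q^a⊠[1-q^b] : (q^ a ⊠ (1# ⊟ q^ b)) n ≡ δ a n - δ (a ℕ.+ b) n
  q^a⊠[1-q^b] = trans (⊠-distribˡ-⊟ (q^ a) 1# (q^ b) n) (cong₂ _-_ (⊠-identityʳ (q^ a) n) (q^-+ a b n))

1-q^-complement : ∀ a → 1# ≗ (1# ⊟ q^ a) ⊞ q^ a
1-q^-complement a n = complement (1# n) (δ a n)
  where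
  complement : ∀ u v → u ≡ (u - v) + v
  complement = solve-∀

poch : ℕ → QSeries
poch l = zSlice (qPoch l) 0

recip : ℕ → ℕ → QSeries
recip a b = zSlice (inv (qPoch a ⊛ qPoch b)) 0

zSlice₀-mono : ∀ a → zSlice (mono a 0) 0 ≗ q^ a
zSlice₀-mono a n = ℤ.*-identityʳ (δ a n)

poch-zero : poch 0 ≗ 1#
poch-zero = zSlice₀-mono 0

poch-suc : ∀ l → poch (suc l) ≗ poch l ⊠ (1# ⊟ q^ suc l)
poch-suc l = ⊠-congʳ (poch l) λ n → cong₂ _-_ (zSlice₀-mono 0 n) (zSlice₀-mono (suc l) n)

poch-constant : ∀ l → poch l 0 ≡ + 1
poch-constant zero = refl
poch-constant (suc l) rewrite poch-constant l = refl

recip-inverse : ∀ a b → recip a b ⊠ (poch a ⊠ poch b) ≗ 1#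
recip-inverse a b n = trans (⊠-comm (recip a b) (poch a ⊠ poch b) n)
  (inv-inverse (qPoch a ⊛ qPoch b) (cong₂ _*_ (poch-constant a) (poch-constant b)) n)

recip-sym : ∀ a b → recip a b ≗ recip b a
recip-sym a b = inverse-unique (poch b ⊠ poch a)
  (λ n → trans (⊠-congʳ (recip a b) (⊠-comm (poch b) (poch a)) n) (recip-inverse a b n))
  (recip-inverse b a)

poch-recip-zero : ∀ N → poch N ⊠ recip 0 N ≗ 1#
poch-recip-zero N = begin
  poch N ⊠ recip 0 N               ≈⟨ ⊠-comm (poch N) (recip 0 N) ⟩
  recip 0 N ⊠ poch N               ≈⟨ ⊠-congʳ (recip 0 N) (⊠-identityˡ (poch N)) ⟨
  recip 0 N ⊠ (1# ⊠ poch N)        ≈⟨ ⊠-congʳ (recip 0 N) (⊠-congˡ (poch N) poch-zero) ⟨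
  recip 0 N ⊠ (poch 0 ⊠ poch N)    ≈⟨ recip-inverse 0 N ⟩
  1#                               ∎
  where open ≗-Reasoning

recip-step : ∀ a b → recip a (suc b) ⊠ (1# ⊟ q^ suc b) ≗ recip a b
recip-step a b = inverse-unique (poch a ⊠ poch b) absorb (recip-inverse a b)
  where
  open ≗-Reasoning
  r = recip a (suc b)
  x = 1# ⊟ q^ suc b
  absorb : r ⊠ x ⊠ (poch a ⊠ poch b) ≗ 1#
  absorb = begin
    r ⊠ x ⊠ (poch a ⊠ poch b)       ≈⟨ ⊠-assoc r x (poch a ⊠ poch b) ⟩
    r ⊠ (x ⊠ (poch a ⊠ poch b))     ≈⟨ ⊠-congʳ r (⊠-comm x (poch a ⊠ poch b)) ⟩
    r ⊠ (poch a ⊠ poch b ⊠ x)       ≈⟨ ⊠-congʳ r (⊠-assoc (poch a) (poch b) x) ⟩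
    r ⊠ (poch a ⊠ (poch b ⊠ x))     ≈⟨ ⊠-congʳ r (⊠-congʳ (poch a) (poch-suc b)) ⟨
    r ⊠ (poch a ⊠ poch (suc b))     ≈⟨ recip-inverse a (suc b) ⟩
    1#                              ∎

recip-split : ∀ a b → recip a (suc b) ≗ recip a b ⊞ q^ suc b ⊠ recip (suc b) a
recip-split a b = begin
    r                                       ≈⟨ ⊠-identityʳ r ⟨
    r ⊠ 1#                                  ≈⟨ ⊠-congʳ r (1-q^-complement (suc b)) ⟩
    r ⊠ ((1# ⊟ q^ suc b) ⊞ q^ suc b)        ≈⟨ ⊠-distribˡ-⊞ r (1# ⊟ q^ suc b) (q^ suc b) ⟩
    r ⊠ (1# ⊟ q^ suc b) ⊞ r ⊠ q^ suc b      ≈⟨ ⊞-cong (recip-step a b) (⊠-comm r (q^ suc b)) ⟩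
    recip a b ⊞ q^ suc b ⊠ r                ≈⟨ ⊞-cong {f = recip a b} (λ _ → refl)
                                                        (⊠-congʳ (q^ suc b) (recip-sym a (suc b))) ⟩
    recip a b ⊞ q^ suc b ⊠ recip (suc b) a  ∎
  where
  open ≗-Reasoning
  r = recip a (suc b)

q-pascal : ∀ a b → poch (suc (suc a ℕ.+ b)) ⊠ recip (suc a) (suc b)
                 ≗ poch (suc a ℕ.+ b) ⊠ recip (suc a) b ⊞ q^ suc b ⊠ (poch (suc a ℕ.+ b) ⊠ recip (suc b) a)
q-pascal a b = begin
    poch (suc (suc a ℕ.+ b)) ⊠ r
  ≈⟨ ⊠-congˡ r (poch-suc (suc a ℕ.+ b)) ⟩
    p ⊠ (1# ⊟ q^ suc (suc a ℕ.+ b)) ⊠ r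
  ≈⟨ ⊠-assoc p (1# ⊟ q^ suc (suc a ℕ.+ b)) r ⟩
    p ⊠ ((1# ⊟ q^ suc (suc a ℕ.+ b)) ⊠ r)
  ≈⟨ ⊠-congʳ p (⊠-congˡ r (1-q^-+′)) ⟩
    p ⊠ (((1# ⊟ q^ suc b) ⊞ q^ suc b ⊠ (1# ⊟ q^ suc a)) ⊠ r)
  ≈⟨ ⊠-congʳ p (distribʳ (1# ⊟ q^ suc b) (q^ suc b ⊠ (1# ⊟ q^ suc a))) ⟩
    p ⊠ ((1# ⊟ q^ suc b) ⊠ r ⊞ q^ suc b ⊠ (1# ⊟ q^ suc a) ⊠ r)
  ≈⟨ ⊠-congʳ p (⊞-cong first second) ⟩
    p ⊠ (recip (suc a) b ⊞ q^ suc b ⊠ recip (suc b) a)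
  ≈⟨ ⊠-distribˡ-⊞ p (recip (suc a) b) (q^ suc b ⊠ recip (suc b) a) ⟩
    p ⊠ recip (suc a) b ⊞ p ⊠ (q^ suc b ⊠ recip (suc b) a)
  ≈⟨ ⊞-cong {f = p ⊠ recip (suc a) b} (λ _ → refl) (swap p (q^ suc b) (recip (suc b) a)) ⟩
    p ⊠ recip (suc a) b ⊞ q^ suc b ⊠ (p ⊠ recip (suc b) a)
  ∎
  where
  open ≗-Reasoning
  p = poch (suc a ℕ.+ b)
  r = recip (suc a) (suc b)
  1-q^-+′ : 1# ⊟ q^ suc (suc a ℕ.+ b) ≗ (1# ⊟ q^ suc b) ⊞ q^ suc b ⊠ (1# ⊟ q^ suc a)
  1-q^-+′ = subst (λ k → 1# ⊟ q^ k ≗ (1# ⊟ q^ suc b) ⊞ q^ suc b ⊠ (1# ⊟ q^ suc a))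
                  (trans (ℕ.+-comm (suc b) (suc a)) (cong suc (ℕ.+-suc a b)))
                  (1-q^-+ (suc b) (suc a))
  distribʳ : ∀ g h → (g ⊞ h) ⊠ r ≗ g ⊠ r ⊞ h ⊠ r
  distribʳ g h n = trans (⊠-comm (g ⊞ h) r n)
    (trans (⊠-distribˡ-⊞ r g h n) (cong₂ _+_ (⊠-comm r g n) (⊠-comm r h n)))
  first : (1# ⊟ q^ suc b) ⊠ r ≗ recip (suc a) b
  first n = trans (⊠-comm (1# ⊟ q^ suc b) r n) (recip-step (suc a) b n)
  second : q^ suc b ⊠ (1# ⊟ q^ suc a) ⊠ r ≗ q^ suc b ⊠ recip (suc b) a
  second = begin
    q^ suc b ⊠ (1# ⊟ q^ suc a) ⊠ r                  ≈⟨ ⊠-assoc (q^ suc b) (1# ⊟ q^ suc a) r ⟩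
    q^ suc b ⊠ ((1# ⊟ q^ suc a) ⊠ r)                ≈⟨ ⊠-congʳ (q^ suc b) (⊠-comm (1# ⊟ q^ suc a) r) ⟩
    q^ suc b ⊠ (r ⊠ (1# ⊟ q^ suc a))                ≈⟨ ⊠-congʳ (q^ suc b)
                                                         (⊠-congˡ (1# ⊟ q^ suc a) (recip-sym (suc a) (suc b))) ⟩
    q^ suc b ⊠ (recip (suc b) (suc a) ⊠ (1# ⊟ q^ suc a)) ≈⟨ ⊠-congʳ (q^ suc b) (recip-step (suc b) a) ⟩
    q^ suc b ⊠ recip (suc b) a                      ∎
  swap : ∀ f g h → f ⊠ (g ⊠ h) ≗ g ⊠ (f ⊠ h)
  swap f g h = begin
    f ⊠ (g ⊠ h)  ≈⟨ ⊠-assoc f g h ⟨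
    f ⊠ g ⊠ h    ≈⟨ ⊠-congˡ h (⊠-comm f g) ⟩
    g ⊠ f ⊠ h    ≈⟨ ⊠-assoc g f h ⟩
    g ⊠ (f ⊠ h)  ∎

-- The coefficient of z^m in the right-hand sides

ConstantPoly : Poly → Set
ConstantPoly p = ∀ m → p (suc m) ≡ + 0

ZFree : Ser → Set
ZFree F = ∀ n → ConstantPoly (F n)

pmul-constant : ∀ {p r} → ConstantPoly p → ConstantPoly r → ConstantPoly (pmul p r)
pmul-constant {p} {r} p-const r-const m = sumTo-zero (suc m) vanish
  where
  vanish : ∀ j → j ≤ suc m → p j * r (suc m ∸ j) ≡ + 0
  vanish zero    _ = trans (cong (p 0 *_) (r-const m)) (ℤ.*-zeroʳ (p 0))
  vanish (suc j) _ = trans (cong (_* r (m ∸ j)) (p-const j)) (ℤ.*-zeroˡ (r (m ∸ j)))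

ZFree-⊛ : ∀ {F G} → ZFree F → ZFree G → ZFree (F ⊛ G)
ZFree-⊛ {F} {G} F-free G-free n m = sumTo-zero n λ i _ → pmul-constant {F i} {G (n ∸ i)} (F-free i) (G-free (n ∸ i)) m

ZFree-⊖ : ∀ {F G} → ZFree F → ZFree G → ZFree (F ⊖ G)
ZFree-⊖ F-free G-free n m rewrite F-free n m | G-free n m = refl

ZFree-mono : ∀ a → ZFree (mono a 0)
ZFree-mono a n m = ℤ.*-zeroʳ (δ a n)

ZFree-qPoch : ∀ l → ZFree (qPoch l)
ZFree-qPoch zero    = ZFree-mono 0
ZFree-qPoch (suc l) = ZFree-⊛ {qPoch l} {oneS ⊖ mono (suc l) 0} (ZFree-qPoch l)
                                (ZFree-⊖ {oneS} {mono (suc l) 0} (ZFree-mono 0) (ZFree-mono (suc l)))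

ZFree-inv : ∀ {F} → ZFree F → ZFree (inv F)
ZFree-inv {F} F-free n = head-constant (invList-constant n)
  where
  convolveTail-constant : ∀ i {ps} → All ConstantPoly ps → ConstantPoly (convolveTail F i ps)
  convolveTail-constant i []                              m = refl
  convolveTail-constant i {p ∷ _} (p-const ∷ ps-const) m =
    cong₂ _+_ (pmul-constant {F i} {p} (F-free i) p-const m) (convolveTail-constant (suc i) ps-const m)
  invList-constant : ∀ j → All ConstantPoly (invList F j)
  invList-constant zero    = (λ _ → refl) ∷ []
  invList-constant (suc j) =
    (λ m → trans (inv-suc F j (suc m)) (cong -_ (convolveTail-constant 1 (invList-constant j) m))) ∷ invList-constant j
  head-constant : ∀ {ps} → All ConstantPoly ps → ConstantPoly (headP ps)
  head-constant []          m = refl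
  head-constant (p-const ∷ _) = p-const

ZFree-inv-qPoch : ∀ a b → ZFree (inv (qPoch a ⊛ qPoch b))
ZFree-inv-qPoch a b = ZFree-inv {qPoch a ⊛ qPoch b} (ZFree-⊛ {qPoch a} {qPoch b} (ZFree-qPoch a) (ZFree-qPoch b))

qBinom-≤ : ∀ {N m} → m ≤ N → qBinom N m ≡ qPoch N ⊛ inv (qPoch m ⊛ qPoch (N ∸ m))
qBinom-≤ {N} {m} m≤N with m ℕ.≤ᵇ N | ℕ.≤⇒≤ᵇ m≤N
... | true | _ = refl

ZFree-qBinom : ∀ N m → ZFree (qBinom N m)
ZFree-qBinom N m with m ℕ.≤ᵇ N
... | true  = ZFree-⊛ {qPoch N} {inv (qPoch m ⊛ qPoch (N ∸ m))} (ZFree-qPoch N) (ZFree-inv-qPoch m (N ∸ m))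
... | false = λ _ _ → refl

zSlice-sumS : ∀ N F m n → zSlice (sumS N F) m n ≡ sumTo N (λ k → F k n m)
zSlice-sumS zero    F m n = refl
zSlice-sumS (suc N) F m n = cong (_+ F (suc N) n m) (zSlice-sumS N F m n)

zSlice-mono-⊛ : ∀ a b G m → (b ≤ m → zSlice (mono a b ⊛ G) m ≗ q^ a ⊠ zSlice G (m ∸ b))
                          × (m < b → zSlice (mono a b ⊛ G) m ≗ 0#)
zSlice-mono-⊛ a b G m = (λ b≤m n → sumTo-cong n λ i _ → trans (proj₁ (collapse n i) b≤m) (at-b n i))
                      , (λ m<b n → sumTo-zero n λ i _ → proj₂ (collapse n i) m<b)
  where
  term : ℕ → ℕ → ℕ → ℤ
  term n i j = δ a i * δ b j * G (n ∸ i) (m ∸ j)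
  annihilate : ∀ x y → x * + 0 * y ≡ + 0
  annihilate = solve-∀
  collapse : ∀ n i → (b ≤ m → sumTo m (term n i) ≡ term n i b) × (m < b → sumTo m (term n i) ≡ + 0)
  collapse n i = sumTo-single m b (term n i) λ j j≢b →
    trans (cong (λ d → δ a i * d * G (n ∸ i) (m ∸ j)) (δ-≢ (j≢b ∘ sym))) (annihilate (δ a i) (G (n ∸ i) (m ∸ j)))
  at-b : ∀ n i → term n i b ≡ δ a i * G (n ∸ i) (m ∸ b)
  at-b n i = cong (_* G (n ∸ i) (m ∸ b)) (trans (cong (δ a i *_) (δ-refl b)) (ℤ.*-identityʳ (δ a i)))

zSlice-diagonal : ∀ N (G : ℕ → Ser) → (∀ k → ZFree (G k)) → ∀ m →
                    (m ≤ N → zSlice (sumS N λ k → mono k k ⊛ G k) m ≗ q^ m ⊠ zSlice (G m) 0)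
                  × (N < m → zSlice (sumS N λ k → mono k k ⊛ G k) m ≗ 0#)
zSlice-diagonal N G G-free m =
    (λ m≤N n → trans (zSlice-sumS N _ m n) (trans (proj₁ (single n) m≤N) (at-m n)))
  , (λ N<m n → trans (zSlice-sumS N _ m n) (proj₂ (single n) N<m))
  where
  term : ℕ → ℕ → ℤ
  term n k = (mono k k ⊛ G k) n m
  off : ∀ n k → k ≢ m → term n k ≡ + 0
  off n k k≢m with k ≤? m
  ... | no  k≰m = proj₂ (zSlice-mono-⊛ k k (G k) m) (ℕ.≰⇒> k≰m) n
  ... | yes k≤m = trans (proj₁ (zSlice-mono-⊛ k k (G k) m) k≤m n) (sumTo-zero n λ i _ →
                    trans (cong (δ k i *_) (higher i)) (ℤ.*-zeroʳ (δ k i)))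
    where
    higher : ∀ i → G k (n ∸ i) (m ∸ k) ≡ + 0
    higher i rewrite ℕ.+-∸-assoc 1 (ℕ.≤∧≢⇒< k≤m k≢m) = G-free k (n ∸ i) (m ∸ suc k)
  single : ∀ n → (m ≤ N → sumTo N (term n) ≡ term n m) × (N < m → sumTo N (term n) ≡ + 0)
  single n = sumTo-single N m (term n) (off n)
  at-m : ∀ n → term n m ≡ (q^ m ⊠ zSlice (G m) 0) n
  at-m n = trans (proj₁ (zSlice-mono-⊛ m m (G m) m) ℕ.≤-refl n)
                 (cong (λ j → (q^ m ⊠ zSlice (G m) j) n) (ℕ.n∸n≡0 m))

zSlice-RHS₁ : ∀ N m {j} → m ≤ N → N ∸ m ≡ j → zSlice (RHS₁ N) m ≗ q^ m ⊠ (poch N ⊠ recip m j)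
zSlice-RHS₁ N m m≤N refl n = trans (proj₁ (zSlice-diagonal N (qBinom N) (ZFree-qBinom N) m) m≤N n)
                                   (cong (λ B → (q^ m ⊠ zSlice B 0) n) (qBinom-≤ m≤N))

zSlice-RHS₁-large : ∀ N m → N < m → zSlice (RHS₁ N) m ≗ 0#
zSlice-RHS₁-large N m = proj₂ (zSlice-diagonal N (qBinom N) (ZFree-qBinom N) m)

zSlice-RHS₂ : ∀ N m {j} → m ≤ N → N ∸ m ≡ j → zSlice (RHS₂ N) m ≗ q^ m ⊠ recip m j
zSlice-RHS₂ N m m≤N refl =
  proj₁ (zSlice-diagonal N (λ k → inv (qPoch k ⊛ qPoch (N ∸ k))) (λ k → ZFree-inv-qPoch k (N ∸ k)) m) m≤N

zSlice-RHS₂-large : ∀ N m → N < m → zSlice (RHS₂ N) m ≗ 0#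
zSlice-RHS₂-large N m =
  proj₂ (zSlice-diagonal N (λ k → inv (qPoch k ⊛ qPoch (N ∸ k))) (λ k → ZFree-inv-qPoch k (N ∸ k)) m)

zSlice-RHS₁-zero : zSlice (RHS₁ 0) 0 ≗ 1#
zSlice-RHS₁-zero n =
  trans (zSlice-RHS₁ 0 0 z≤n refl n) (trans (⊠-identityˡ (poch 0 ⊠ recip 0 0) n) (poch-recip-zero 0 n))

zSlice-RHS₂-zero : zSlice (RHS₂ 0) 0 ≗ 1#
zSlice-RHS₂-zero n = trans (zSlice-RHS₂ 0 0 z≤n refl n)
  (trans (⊠-congˡ (recip 0 0) (λ k → sym (poch-zero k)) n) (poch-recip-zero 0 n))

zSlice-RHS₁-suc : ∀ N m → m ≤ suc N →
  zSlice (RHS₁ (suc N)) m ≗ zSlice (RHS₁ N) m ⊞ q^ m ⊠ zSlice (RHS₁ N) (suc N ∸ m)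
zSlice-RHS₁-suc N m m≤1+N with ℕ.m≤n⇒m<n∨m≡n m≤1+N
zSlice-RHS₁-suc N .(suc N) _ | inj₂ refl = begin
    zSlice (RHS₁ (suc N)) (suc N)
  ≈⟨ zSlice-RHS₁ (suc N) (suc N) ℕ.≤-refl (ℕ.n∸n≡0 N) ⟩
    q^ suc N ⊠ (poch (suc N) ⊠ recip (suc N) 0)
  ≈⟨ ⊠-congʳ (q^ suc N) unit ⟩
    q^ suc N ⊠ (q^ 0 ⊠ (poch N ⊠ recip 0 N))
  ≈⟨ ⊠-congʳ (q^ suc N) (zSlice-RHS₁ N 0 z≤n refl) ⟨
    q^ suc N ⊠ zSlice (RHS₁ N) 0
  ≈⟨ ⊠-congʳ (q^ suc N) (zSlice-index (RHS₁ N) (ℕ.n∸n≡0 N)) ⟨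
    q^ suc N ⊠ zSlice (RHS₁ N) (N ∸ N)
  ≈⟨ ⊞-identityˡ (q^ suc N ⊠ zSlice (RHS₁ N) (N ∸ N)) ⟨
    0# ⊞ q^ suc N ⊠ zSlice (RHS₁ N) (N ∸ N)
  ≈⟨ ⊞-cong (zSlice-RHS₁-large N (suc N) ℕ.≤-refl) (λ _ → refl) ⟨
    zSlice (RHS₁ N) (suc N) ⊞ q^ suc N ⊠ zSlice (RHS₁ N) (N ∸ N)
  ∎
  where
  open ≗-Reasoning
  unit : poch (suc N) ⊠ recip (suc N) 0 ≗ q^ 0 ⊠ (poch N ⊠ recip 0 N)
  unit n = trans (⊠-congʳ (poch (suc N)) (recip-sym (suc N) 0) n)
          (trans (poch-recip-zero (suc N) n)
          (sym (trans (⊠-identityˡ (poch N ⊠ recip 0 N) n) (poch-recip-zero N n))))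
zSlice-RHS₁-suc N zero _ | inj₁ _ = begin
    zSlice (RHS₁ (suc N)) 0
  ≈⟨ zSlice-RHS₁ (suc N) 0 z≤n refl ⟩
    q^ 0 ⊠ (poch (suc N) ⊠ recip 0 (suc N))
  ≈⟨ ⊠-congʳ (q^ 0) (λ n → trans (poch-recip-zero (suc N) n) (sym (poch-recip-zero N n))) ⟩
    q^ 0 ⊠ (poch N ⊠ recip 0 N)
  ≈⟨ zSlice-RHS₁ N 0 z≤n refl ⟨
    zSlice (RHS₁ N) 0
  ≈⟨ ⊞-identityʳ (zSlice (RHS₁ N) 0) ⟨
    zSlice (RHS₁ N) 0 ⊞ 0#
  ≈⟨ ⊞-cong {f = zSlice (RHS₁ N) 0} (λ _ → refl) vanish ⟨
    zSlice (RHS₁ N) 0 ⊞ q^ 0 ⊠ zSlice (RHS₁ N) (suc N)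
  ∎
  where
  open ≗-Reasoning
  vanish : q^ 0 ⊠ zSlice (RHS₁ N) (suc N) ≗ 0#
  vanish n = trans (⊠-congʳ (q^ 0) (zSlice-RHS₁-large N (suc N) ℕ.≤-refl) n) (⊠-zeroʳ (q^ 0) n)
zSlice-RHS₁-suc N (suc a) _ | inj₁ a<N with ℕ.m≤n⇒∃[o]m+o≡n (ℕ.≤-pred a<N)
... | b , refl = begin
    zSlice (RHS₁ (suc (suc a ℕ.+ b))) (suc a)
  ≈⟨ zSlice-RHS₁ (suc (suc a ℕ.+ b)) (suc a) (ℕ.m≤n⇒m≤1+n (ℕ.m≤m+n (suc a) b)) tail-index ⟩
    q^ suc a ⊠ (poch (suc (suc a ℕ.+ b)) ⊠ recip (suc a) (suc b))
  ≈⟨ ⊠-congʳ (q^ suc a) (q-pascal a b) ⟩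
    q^ suc a ⊠ (p ⊠ recip (suc a) b ⊞ q^ suc b ⊠ (p ⊠ recip (suc b) a))
  ≈⟨ ⊠-distribˡ-⊞ (q^ suc a) (p ⊠ recip (suc a) b) (q^ suc b ⊠ (p ⊠ recip (suc b) a)) ⟩
    q^ suc a ⊠ (p ⊠ recip (suc a) b) ⊞ q^ suc a ⊠ (q^ suc b ⊠ (p ⊠ recip (suc b) a))
  ≈⟨ ⊞-cong (zSlice-RHS₁ (suc a ℕ.+ b) (suc a) (ℕ.m≤m+n (suc a) b) (ℕ.m+n∸m≡n (suc a) b))
            (⊠-congʳ (q^ suc a) (zSlice-RHS₁ (suc a ℕ.+ b) (suc b) (s≤s (ℕ.m≤n+m b a)) (ℕ.m+n∸n≡m a b))) ⟨
    zSlice (RHS₁ (suc a ℕ.+ b)) (suc a) ⊞ q^ suc a ⊠ zSlice (RHS₁ (suc a ℕ.+ b)) (suc b)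
  ≈⟨ ⊞-cong {f = zSlice (RHS₁ (suc a ℕ.+ b)) (suc a)} (λ _ → refl)
            (⊠-congʳ (q^ suc a) (zSlice-index (RHS₁ (suc a ℕ.+ b)) tail-index)) ⟨
    zSlice (RHS₁ (suc a ℕ.+ b)) (suc a) ⊞ q^ suc a ⊠ zSlice (RHS₁ (suc a ℕ.+ b)) (suc (suc a ℕ.+ b) ∸ suc a)
  ∎
  where
  open ≗-Reasoning
  p = poch (suc a ℕ.+ b)
  tail-index : suc (suc a ℕ.+ b) ∸ suc a ≡ suc b
  tail-index = trans (cong (_∸ a) (sym (ℕ.+-suc a b))) (ℕ.m+n∸m≡n a (suc b))

zSlice-RHS₂-suc : ∀ N m → m ≤ suc N →
  zSlice (RHS₂ (suc N)) m ≗ zSlice (RHS₂ N) m ⊞ q^ m ⊠ zSlice (RHS₂ (suc N)) (suc N ∸ m)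
zSlice-RHS₂-suc N m m≤1+N with ℕ.m≤n⇒m<n∨m≡n m≤1+N
zSlice-RHS₂-suc N .(suc N) _ | inj₂ refl = begin
    zSlice (RHS₂ (suc N)) (suc N)
  ≈⟨ zSlice-RHS₂ (suc N) (suc N) ℕ.≤-refl (ℕ.n∸n≡0 N) ⟩
    q^ suc N ⊠ recip (suc N) 0
  ≈⟨ ⊠-congʳ (q^ suc N) (recip-sym (suc N) 0) ⟩
    q^ suc N ⊠ recip 0 (suc N)
  ≈⟨ ⊠-congʳ (q^ suc N) (⊠-identityˡ (recip 0 (suc N))) ⟨
    q^ suc N ⊠ (q^ 0 ⊠ recip 0 (suc N))
  ≈⟨ ⊠-congʳ (q^ suc N)
             (λ n → trans (zSlice-index (RHS₂ (suc N)) (ℕ.n∸n≡0 N) n) (zSlice-RHS₂ (suc N) 0 z≤n refl n)) ⟨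
    q^ suc N ⊠ zSlice (RHS₂ (suc N)) (N ∸ N)
  ≈⟨ ⊞-identityˡ (q^ suc N ⊠ zSlice (RHS₂ (suc N)) (N ∸ N)) ⟨
    0# ⊞ q^ suc N ⊠ zSlice (RHS₂ (suc N)) (N ∸ N)
  ≈⟨ ⊞-cong (zSlice-RHS₂-large N (suc N) ℕ.≤-refl) (λ _ → refl) ⟨
    zSlice (RHS₂ N) (suc N) ⊞ q^ suc N ⊠ zSlice (RHS₂ (suc N)) (N ∸ N)
  ∎
  where open ≗-Reasoning
zSlice-RHS₂-suc N m _ | inj₁ m<1+N with ℕ.m≤n⇒∃[o]m+o≡n (ℕ.≤-pred m<1+N)
... | b , refl = begin
    zSlice (RHS₂ (suc (m ℕ.+ b))) m
  ≈⟨ zSlice-RHS₂ (suc (m ℕ.+ b)) m (ℕ.m≤n⇒m≤1+n (ℕ.m≤m+n m b)) tail-index ⟩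
    q^ m ⊠ recip m (suc b)
  ≈⟨ ⊠-congʳ (q^ m) (recip-split m b) ⟩
    q^ m ⊠ (recip m b ⊞ q^ suc b ⊠ recip (suc b) m)
  ≈⟨ ⊠-distribˡ-⊞ (q^ m) (recip m b) (q^ suc b ⊠ recip (suc b) m) ⟩
    q^ m ⊠ recip m b ⊞ q^ m ⊠ (q^ suc b ⊠ recip (suc b) m)
  ≈⟨ ⊞-cong (zSlice-RHS₂ (m ℕ.+ b) m (ℕ.m≤m+n m b) (ℕ.m+n∸m≡n m b))
            (⊠-congʳ (q^ m) (zSlice-RHS₂ (suc (m ℕ.+ b)) (suc b) (s≤s (ℕ.m≤n+m b m)) (ℕ.m+n∸n≡m m b))) ⟨
    zSlice (RHS₂ (m ℕ.+ b)) m ⊞ q^ m ⊠ zSlice (RHS₂ (suc (m ℕ.+ b))) (suc b)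
  ≈⟨ ⊞-cong {f = zSlice (RHS₂ (m ℕ.+ b)) m} (λ _ → refl)
            (⊠-congʳ (q^ m) (zSlice-index (RHS₂ (suc (m ℕ.+ b))) tail-index)) ⟨
    zSlice (RHS₂ (m ℕ.+ b)) m ⊞ q^ m ⊠ zSlice (RHS₂ (suc (m ℕ.+ b))) (suc (m ℕ.+ b) ∸ m)
  ∎
  where
  open ≗-Reasoning
  tail-index : suc (m ℕ.+ b) ∸ m ≡ suc b
  tail-index = trans (ℕ.+-∸-assoc 1 (ℕ.m≤m+n m b)) (cong suc (ℕ.m+n∸m≡n m b))

WithStats : (List ℕ → Set) → ℕ → ℕ → List ℕ → Set
WithStats P n m π = P π × 𝒪 π ≡ n × γ π ≡ + m

StartsWith : ℕ → (List ℕ → Set) → List ℕ → Set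
StartsWith a P π = Σ (List ℕ) λ τ → π ≡ a ∷ τ × P τ

Parts : ℕ → List ℕ → Set
Parts N = All (λ x → 0 < x × x ≤ N)

parts-weaken : ∀ {N π} → Parts N π → Parts (suc N) π
parts-weaken = All.map λ (0<x , x≤N) → 0<x , ℕ.m≤n⇒m≤1+n x≤N

parts-narrow : ∀ {N π} → Parts (suc N) π → All (_≤ N) π → Parts N π
parts-narrow ps bounds = All.zipWith (λ ((0<x , _) , x≤N) → 0<x , x≤N) (ps , bounds)

parts-zero : ∀ {π} → Parts 0 π → π ≡ []
parts-zero []              = refl
parts-zero ((0<x , x≤0) ∷ _) = ⊥-elim (ℕ.<⇒≱ 0<x x≤0)

module _ {P Q : List ℕ → Set} where

  hasCardinality-resp : ∀ {c d} → (∀ π → P π ⇔ Q π) → c ≡ d → HasCardinality P c → HasCardinality Q d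
  hasCardinality-resp P⇔Q refl (L , unique , complete , size) =
    L , unique , (λ π → to (P⇔Q π) ∘ proj₁ (complete π) , proj₂ (complete π) ∘ from (P⇔Q π)) , size

  hasCardinality-⊎ : ∀ {a b} → HasCardinality P a → HasCardinality Q b → (∀ {π} → P π → ¬ Q π) →
                     HasCardinality (λ π → P π ⊎ Q π) (a + b)
  hasCardinality-⊎ {a} {b} (L , L-unique , L-complete , L-size) (M , M-unique , M-complete , M-size) P⇒¬Q =
    L ++ M , Unique.++⁺ L-unique M-unique disjoint , complete , size
    where
    disjoint : ∀ {π} → ¬ (π ∈ L × π ∈ M)
    disjoint {π} (π∈L , π∈M) = P⇒¬Q (proj₁ (L-complete π) π∈L) (proj₁ (M-complete π) π∈M)
    complete : ∀ π → (π ∈ L ++ M → P π ⊎ Q π) × (P π ⊎ Q π → π ∈ L ++ M)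
    complete π = [ inj₁ ∘ proj₁ (L-complete π) , inj₂ ∘ proj₁ (M-complete π) ] ∘ ∈-++⁻ L
               , [ ∈-++⁺ˡ ∘ proj₂ (L-complete π) , ∈-++⁺ʳ L ∘ proj₂ (M-complete π) ]
    size : + length (L ++ M) ≡ a + b
    size = trans (cong +_ (length-++ L)) (trans (ℤ.pos-+ (length L) (length M)) (cong₂ _+_ L-size M-size))

hasCardinality-∅ : ∀ {P : List ℕ → Set} → (∀ π → ¬ P π) → HasCardinality P (+ 0)
hasCardinality-∅ ¬P = [] , [] , (λ π → (λ ()) , ⊥-elim ∘ ¬P π) , refl

hasCardinality-[] : HasCardinality (_≡ []) (+ 1)
hasCardinality-[] = [] ∷ [] , [] ∷ [] , (λ π → (λ { (here refl) → refl }) , λ { refl → here refl }) , refl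

hasCardinality-StartsWith : ∀ {P c} a → HasCardinality P c → HasCardinality (StartsWith a P) c
hasCardinality-StartsWith {P} a (L , unique , complete , size) =
  map (a ∷_) L , Unique.map⁺ ∷-injectiveʳ unique , complete′ , trans (cong +_ (length-map (a ∷_) L)) size
  where
  complete′ : ∀ π → (π ∈ map (a ∷_) L → StartsWith a P π) × (StartsWith a P π → π ∈ map (a ∷_) L)
  complete′ π = (λ π∈ → let τ , τ∈L , π≡a∷τ = ∈-map⁻ (a ∷_) π∈ in τ , π≡a∷τ , proj₁ (complete τ) τ∈L)
              , λ { (τ , refl , Pτ) → ∈-map⁺ (a ∷_) (proj₂ (complete τ) Pτ) }

-- Deleting the first part of a partition

+-∸ : ∀ {a m} → m ≤ a → + a - + m ≡ + (a ∸ m)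
+-∸ {a} {m} m≤a = trans (ℤ.m-n≡m⊖n a m) (ℤ.⊖-≥ m≤a)

𝒪-∷ : ∀ a τ → + 𝒪 (a ∷ τ) ≡ γ (a ∷ τ) + + 𝒪 τ
𝒪-∷ a []      = identity (+ a)
  where
  identity : ∀ x → x ≡ (x - + 0) + + 0
  identity = solve-∀
𝒪-∷ a (b ∷ ρ) = begin
  + (a ℕ.+ 𝒪 ρ)                                   ≡⟨ ℤ.pos-+ a (𝒪 ρ) ⟩
  + a + + 𝒪 ρ                                     ≡⟨ regroup (+ a) (+ b - γ ρ) (+ 𝒪 ρ) ⟩
  (+ a - (+ b - γ ρ)) + ((+ b - γ ρ) + + 𝒪 ρ)     ≡⟨ cong (λ x → (+ a - (+ b - γ ρ)) + x) (𝒪-∷ b ρ) ⟨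
  (+ a - (+ b - γ ρ)) + + 𝒪 (b ∷ ρ)               ∎
  where
  open ≡-Reasoning
  regroup : ∀ x g o → x + o ≡ (x - g) + (g + o)
  regroup = solve-∀

γ-head-bound : ∀ {x xs} → Linked _≥_ (x ∷ xs) → Σ ℕ λ k → k ≤ x × γ (x ∷ xs) ≡ + k
γ-head-bound {x} [-] = x , ℕ.≤-refl , ℤ.+-identityʳ (+ x)
γ-head-bound {x} (x≥y ∷ l) with γ-head-bound l
... | k , k≤y , γ≡k = x ∸ k , ℕ.m∸n≤m x k , trans (cong (λ g → + x - g) γ≡k) (+-∸ (ℕ.≤-trans k≤y x≥y))

γ-≤-bound : ∀ {N m π} → Linked _≥_ π → Parts N π → γ π ≡ + m → m ≤ N
γ-≤-bound {π = []}        _ _               refl = z≤n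
γ-≤-bound {N} {π = _ ∷ _} l ((_ , x≤N) ∷ _) γ≡m =
  let k , k≤x , γ≡k = γ-head-bound l in subst (_≤ N) (ℤ.+-injective (trans (sym γ≡k) γ≡m)) (ℕ.≤-trans k≤x x≤N)

∷-stats : ∀ {a n m} τ → m ≤ n → m ≤ a →
          (𝒪 (a ∷ τ) ≡ n × γ (a ∷ τ) ≡ + m) ⇔ (𝒪 τ ≡ n ∸ m × γ τ ≡ + (a ∸ m))
∷-stats {a} {n} {m} τ m≤n m≤a = mk⇔ forward backward
  where
  open ≡-Reasoning
  negate-twice : ∀ x g → g ≡ x - (x - g)
  negate-twice = solve-∀
  forward : 𝒪 (a ∷ τ) ≡ n × γ (a ∷ τ) ≡ + m → 𝒪 τ ≡ n ∸ m × γ τ ≡ + (a ∸ m)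
  forward (refl , γ≡m) = ℤ.+-injective 𝒪τ≡ , γτ≡
    where
    γτ≡ : γ τ ≡ + (a ∸ m)
    γτ≡ = begin
      γ τ                 ≡⟨ negate-twice (+ a) (γ τ) ⟩
      + a - γ (a ∷ τ)     ≡⟨ cong (λ g → + a - g) γ≡m ⟩
      + a - + m           ≡⟨ +-∸ m≤a ⟩
      + (a ∸ m)           ∎
    shift : ∀ o g → o ≡ (g + o) - g
    shift = solve-∀
    𝒪τ≡ : + 𝒪 τ ≡ + (𝒪 (a ∷ τ) ∸ m)
    𝒪τ≡ = begin
      + 𝒪 τ                               ≡⟨ shift (+ 𝒪 τ) (γ (a ∷ τ)) ⟩
      (γ (a ∷ τ) + + 𝒪 τ) - γ (a ∷ τ)     ≡⟨ cong₂ _-_ (𝒪-∷ a τ) (sym γ≡m) ⟨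
      + 𝒪 (a ∷ τ) - + m                   ≡⟨ +-∸ m≤n ⟩
      + (𝒪 (a ∷ τ) ∸ m)                   ∎
  backward : 𝒪 τ ≡ n ∸ m × γ τ ≡ + (a ∸ m) → 𝒪 (a ∷ τ) ≡ n × γ (a ∷ τ) ≡ + m
  backward (𝒪τ≡ , γτ≡) = ℤ.+-injective 𝒪≡ , γ≡
    where
    γ≡ : γ (a ∷ τ) ≡ + m
    γ≡ = begin
      + a - γ τ           ≡⟨ cong (λ g → + a - g) (trans γτ≡ (sym (+-∸ m≤a))) ⟩
      + a - (+ a - + m)   ≡⟨ negate-twice (+ a) (+ m) ⟨
      + m                 ∎
    𝒪≡ : + 𝒪 (a ∷ τ) ≡ + n
    𝒪≡ = begin
      + 𝒪 (a ∷ τ)          ≡⟨ 𝒪-∷ a τ ⟩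
      γ (a ∷ τ) + + 𝒪 τ    ≡⟨ cong₂ (λ g o → g + + o) γ≡ 𝒪τ≡ ⟩
      + m + + (n ∸ m)      ≡⟨ ℤ.pos-+ m (n ∸ m) ⟨
      + (m ℕ.+ (n ∸ m))    ≡⟨ cong +_ (ℕ.m+[n∸m]≡n m≤n) ⟩
      + n                  ∎

StartsWith-stats : ∀ {P a n m} → m ≤ n → m ≤ a →
                   ∀ π → StartsWith a (WithStats P (n ∸ m) (a ∸ m)) π ⇔ WithStats (StartsWith a P) n m π
StartsWith-stats m≤n m≤a π = mk⇔
  (λ { (τ , refl , Pτ , stats) → (τ , refl , Pτ) , from (∷-stats τ m≤n m≤a) stats })
  (λ { ((τ , refl , Pτ) , stats) → let 𝒪τ≡ , γτ≡ = to (∷-stats τ m≤n m≤a) stats in τ , refl , Pτ , 𝒪τ≡ , γτ≡ })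

StartsWith-stats-empty : ∀ {P a n m} → n < m → ∀ π → ¬ WithStats (StartsWith a P) n m π
StartsWith-stats-empty {a = a} {m = m} n<m π ((τ , refl , _) , refl , γ≡m) =
  ℕ.<⇒≱ n<m (subst (m ℕ.≤_) (ℤ.+-injective 𝒪≡) (ℕ.m≤m+n m (𝒪 τ)))
  where
  𝒪≡ : + (m ℕ.+ 𝒪 τ) ≡ + 𝒪 (a ∷ τ)
  𝒪≡ = trans (ℤ.pos-+ m (𝒪 τ)) (trans (cong (_+ + 𝒪 τ) (sym γ≡m)) (sym (𝒪-∷ a τ)))

StartsWith-excluded : ∀ {N Q π} → Parts N π → ¬ StartsWith (suc N) Q π
StartsWith-excluded ((_ , N<N) ∷ _) (_ , refl , _) = ℕ.<-irrefl refl N<N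

below-head : ∀ {R : ℕ → ℕ → Set} {x xs} → (∀ {i j k} → R i j → R j k → R i k) →
             Linked R (x ∷ xs) → All (R x) xs
below-head trans [-]       = []
below-head trans (r ∷ l)   = Linked⇒All trans r l

linked-∷ : ∀ {R : ℕ → ℕ → Set} {B : ℕ → Set} {x τ} → (∀ {y} → B y → R x y) →
           All B τ → Linked R τ → Linked R (x ∷ τ)
linked-∷ link []      []  = [-]
linked-∷ link (b ∷ _) l   = link b ∷ l

distinct-split : ∀ N π → IsDistinctPartitionLe (suc N) π
                       ⇔ (IsDistinctPartitionLe N π ⊎ StartsWith (suc N) (IsDistinctPartitionLe N) π)
distinct-split N π = mk⇔ (split π) [ (λ (l , ps) → l , parts-weaken ps) , extend ]
  where
  below : ∀ {x xs} → Linked _>_ (x ∷ xs) → All (_< x) xs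
  below = below-head (λ i>j j>k → ℕ.<-trans j>k i>j)
  split : ∀ π → IsDistinctPartitionLe (suc N) π → IsDistinctPartitionLe N π ⊎ StartsWith (suc N) (IsDistinctPartitionLe N) π
  split []       _                            = inj₁ ([] , [])
  split (x ∷ xs) (l , ps@((_ , x≤1+N) ∷ ps′)) with x ≤? N
  ... | yes x≤N = inj₁ (l , parts-narrow ps (x≤N ∷ All.map (λ y<x → ℕ.<⇒≤ (ℕ.<-≤-trans y<x x≤N)) (below l)))
  ... | no  x≰N = inj₂ (xs , cong (_∷ xs) (ℕ.≤-antisym x≤1+N (ℕ.≰⇒> x≰N)) , Linked.tail l
                       , parts-narrow ps′ (All.map (λ y<x → ℕ.≤-pred (ℕ.<-≤-trans y<x x≤1+N)) (below l)))
  extend : StartsWith (suc N) (IsDistinctPartitionLe N) π → IsDistinctPartitionLe (suc N) π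
  extend (τ , refl , l , ps) = linked-∷ (λ (_ , y≤N) → s≤s y≤N) ps l , (s≤s z≤n , ℕ.≤-refl) ∷ parts-weaken ps

partition-split : ∀ N π → IsPartitionLe (suc N) π
                        ⇔ (IsPartitionLe N π ⊎ StartsWith (suc N) (IsPartitionLe (suc N)) π)
partition-split N π = mk⇔ (split π) [ (λ (l , ps) → l , parts-weaken ps) , extend ]
  where
  below : ∀ {x xs} → Linked _≥_ (x ∷ xs) → All (_≤ x) xs
  below = below-head (λ i≥j j≥k → ℕ.≤-trans j≥k i≥j)
  split : ∀ π → IsPartitionLe (suc N) π → IsPartitionLe N π ⊎ StartsWith (suc N) (IsPartitionLe (suc N)) π
  split []       _                            = inj₁ ([] , [])
  split (x ∷ xs) (l , ps@((_ , x≤1+N) ∷ ps′)) with x ≤? N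
  ... | yes x≤N = inj₁ (l , parts-narrow ps (x≤N ∷ All.map (λ y≤x → ℕ.≤-trans y≤x x≤N) (below l)))
  ... | no  x≰N = inj₂ (xs , cong (_∷ xs) (ℕ.≤-antisym x≤1+N (ℕ.≰⇒> x≰N)) , Linked.tail l , ps′)
  extend : StartsWith (suc N) (IsPartitionLe (suc N)) π → IsPartitionLe (suc N) π
  extend (τ , refl , l , ps) = linked-∷ proj₂ ps l , (s≤s z≤n , ℕ.≤-refl) ∷ ps

WithStats-⊎ : ∀ {A B D : List ℕ → Set} {n m} → (∀ π → A π ⇔ (B π ⊎ D π)) →
              ∀ π → WithStats A n m π ⇔ (WithStats B n m π ⊎ WithStats D n m π)
WithStats-⊎ split π = mk⇔
  (λ (Aπ , stats) → [ inj₁ ∘ (_, stats) , inj₂ ∘ (_, stats) ] (to (split π) Aπ))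
  [ (λ (Bπ , stats) → from (split π) (inj₁ Bπ) , stats) , (λ (Dπ , stats) → from (split π) (inj₂ Dπ) , stats) ]

StartsWith-count : ∀ {C a n m} (f : QSeries) → m ≤ a →
                   (m ≤ n → HasCardinality (WithStats C (n ∸ m) (a ∸ m)) (f (n ∸ m))) →
                   HasCardinality (WithStats (StartsWith a C) n m) ((q^ m ⊠ f) n)
StartsWith-count {a = a} {n} {m} f m≤a C-count with m ≤? n
... | yes m≤n = hasCardinality-resp (StartsWith-stats m≤n m≤a) (sym (proj₁ (q^-⊠ m f n) m≤n))
                                    (hasCardinality-StartsWith a (C-count m≤n))
... | no  m≰n = subst (HasCardinality _) (sym (proj₂ (q^-⊠ m f n) (ℕ.≰⇒> m≰n)))
                      (hasCardinality-∅ (StartsWith-stats-empty (ℕ.≰⇒> m≰n)))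

first-part-recurrence : ∀ {A B C : List ℕ → Set} {a n m x} (f : QSeries) →
                        (∀ π → A π ⇔ (B π ⊎ StartsWith a C π)) → (∀ {π} → B π → ¬ StartsWith a C π) →
                        m ≤ a →
                        HasCardinality (WithStats B n m) x →
                        (m ≤ n → HasCardinality (WithStats C (n ∸ m) (a ∸ m)) (f (n ∸ m))) →
                        HasCardinality (WithStats A n m) (x + (q^ m ⊠ f) n)
first-part-recurrence f split disjoint m≤a B-count C-count =
  hasCardinality-resp (λ π → ⇔-sym (WithStats-⊎ split π)) refl
    (hasCardinality-⊎ B-count (StartsWith-count f m≤a C-count) (λ (Bπ , _) (h , _) → disjoint Bπ h))

large-γ-count : ∀ {A : List ℕ → Set} {N n m} → (∀ {π} → A π → Linked _≥_ π × Parts N π) → N < m →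
                HasCardinality (WithStats A n m) (+ 0)
large-γ-count shape N<m = hasCardinality-∅ λ π (Aπ , _ , γ≡m) →
  let l , ps = shape Aπ in ℕ.<⇒≱ N<m (γ-≤-bound l ps γ≡m)

zero-bound-count : ∀ {A : List ℕ → Set} → (∀ {π} → A π → Parts 0 π) → A [] →
                   ∀ n → HasCardinality (WithStats A n 0) (1# n)
zero-bound-count parts A[] zero    = hasCardinality-resp
  (λ π → mk⇔ (λ { refl → A[] , refl , refl }) (λ (Aπ , _) → parts-zero (parts Aπ))) refl hasCardinality-[]
zero-bound-count parts A[] (suc n) = hasCardinality-∅ λ π (Aπ , 𝒪≡ , _) →
  ℕ.0≢1+n (trans (cong 𝒪 (sym (parts-zero (parts Aπ)))) 𝒪≡)

distinct-count : ∀ N n m → HasCardinality (WithStats (IsDistinctPartitionLe N) n m) (RHS₁ N n m)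
distinct-count N n m with m ≤? N
... | no m≰N = subst (HasCardinality _) (sym (zSlice-RHS₁-large N m (ℕ.≰⇒> m≰N) n))
                     (large-γ-count (λ (l , ps) → Linked.map ℕ.<⇒≤ l , ps) (ℕ.≰⇒> m≰N))
distinct-count zero    n .0 | yes z≤n   =
  subst (HasCardinality _) (sym (zSlice-RHS₁-zero n)) (zero-bound-count proj₂ ([] , []) n)
distinct-count (suc N) n m  | yes m≤1+N =
  subst (HasCardinality _) (sym (zSlice-RHS₁-suc N m m≤1+N n))
    (first-part-recurrence (zSlice (RHS₁ N) (suc N ∸ m)) (distinct-split N) (StartsWith-excluded ∘ proj₂) m≤1+N
                           (distinct-count N n m) (λ _ → distinct-count N (n ∸ m) (suc N ∸ m)))

partition-count : ∀ N n m → HasCardinality (WithStats (IsPartitionLe N) n m) (RHS₂ N n m)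
partition-count N n m with m ≤? N
... | no m≰N = subst (HasCardinality _) (sym (zSlice-RHS₂-large N m (ℕ.≰⇒> m≰N) n))
                     (large-γ-count (λ p → p) (ℕ.≰⇒> m≰N))
partition-count zero    n .0 | yes z≤n   =
  subst (HasCardinality _) (sym (zSlice-RHS₂-zero n)) (zero-bound-count proj₂ ([] , []) n)
partition-count (suc N) n m  | yes m≤1+N = <-rec Count count n m m≤1+N
  where
  Count : ℕ → Set
  Count n = ∀ m → m ≤ suc N → HasCardinality (WithStats (IsPartitionLe (suc N)) n m) (RHS₂ (suc N) n m)
  recurrence : ∀ n m → m ≤ suc N →
    (m ≤ n → HasCardinality (WithStats (IsPartitionLe (suc N)) (n ∸ m) (suc N ∸ m)) (RHS₂ (suc N) (n ∸ m) (suc N ∸ m))) →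
    HasCardinality (WithStats (IsPartitionLe (suc N)) n m) (RHS₂ (suc N) n m)
  recurrence n m m≤1+N tail-count = subst (HasCardinality _) (sym (zSlice-RHS₂-suc N m m≤1+N n))
    (first-part-recurrence (zSlice (RHS₂ (suc N)) (suc N ∸ m)) (partition-split N) (StartsWith-excluded ∘ proj₂) m≤1+N
                           (partition-count N n m) tail-count)
  count : ∀ n → (∀ {n′} → n′ < n → Count n′) → Count n
  count n smaller (suc k) m≤1+N = recurrence n (suc k) m≤1+N λ k<n →
    smaller (ℕ.∸-monoʳ-< z<s k<n) (suc N ∸ suc k) (ℕ.m∸n≤m (suc N) (suc k))
  -- For m = 0 the tail has γ = N + 1 at the same n; its own tail has smaller n.
  count n smaller zero    _     = recurrence n 0 z≤n λ _ → recurrence n (suc N) ℕ.≤-refl λ N<n →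
    smaller (ℕ.∸-monoʳ-< z<s N<n) (N ∸ N) (ℕ.m∸n≤m (suc N) (suc N))

theorem2p5 : (N : ℕ) →
    ((n m : ℕ) → HasCardinality (λ π → IsDistinctPartitionLe N π × 𝒪 π ≡ n × γ π ≡ + m) (RHS₁ N n m))
    × ((n m : ℕ) → HasCardinality (λ π → IsPartitionLe N π × 𝒪 π ≡ n × γ π ≡ + m) (RHS₂ N n m))
theorem2p5 N = distinct-count N , partition-count N
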